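{- Define four families of polynomials $f^{(i)}(X), t^{(i)}(X), d^{(i)}(X), s^{(i)}(X)$ ($i \ge 0$) with integer coefficients by the simultaneous recursions $$f^{(0)}(X)=1;\qquad t^{(i)}(X)=\sum_{j=0}^{i}\binom{i}{j}X^{i-j}f^{(j)}(X)\ (i\ge 0);\qquad d^{(i)}(X)=t^{(i)}(X)-X\,f^{(i)}(X)\ (i\ge 0);$$ $$s^{(i)}(X)=f^{(i)}(X)+d^{(i)}(X)\ (i\ge 0);\qquad f^{(i)}(X)=\sum_{j=0}^{i-1}\binom{i}{j}X^{i-1-j}s^{(j)}(X)\ (i\ge 1).$$ Let $m\ge 1$ be an integer and let $(G_k)_{k\ge 0}$ be the metallic sequence of order $m$: $G_0=0$, $G_1=1$, $G_k=mG_{k-1}+G_{k-2}$ for $k\ge 2$. Fix an integer $p\ge 1$ and define the polynomials (in a variable $n$) $$F(n)=\sum_{i=0}^{p}\frac{f^{(i)}(m)}{m^{i+1}}(-1)^i\binom{p}{i}n^{p-i},\qquad T(n)=\sum_{i=0}^{p}\frac{t^{(i)}(m)}{m^{i+1}}(-1)^i\binom{p}{i}n^{p-i}.$$ Then $F$ and $T$ are polynomials of degree $p$ with rational coefficients, and for every integer $n\ge 0$, $$\sum_{k=0}^{n}k^p G_k = F(n)\,G_n + T(n)\,G_{n+1} - T_0,$$ where $T_0$ denotes the constant coefficient of the polynomial $T$.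
   Context: The sequence $G$ depends on $m$; for $m=1$ it is the Fibonacci sequence and for $m=2$ the Pell sequence. For a polynomial $r(x)=\sum_i r_i x^i$, $r_i$ denotes the coefficient of $x^i$. -}

module Defs where

open import Data.Nat as ℕ using (ℕ; zero; suc; _∸_; _≤ᵇ_; NonZero)
open import Data.Nat.Properties using (m^n≢0)
open import Data.Nat.Combinatorics using (_C_)
open import Data.Integer as ℤ using (ℤ; +_; -[1+_])
open import Data.Rational as ℚ using (ℚ; 0ℚ)
open import Data.Bool using (if_then_else_)
open import Data.Product using (_×_)
open import Relation.Binary.PropositionalEquality using (_≡_; _≢_)

sumℤ : ℕ → (ℕ → ℤ) → ℤ
sumℤ zero    g = + 0
sumℤ (suc n) g = sumℤ n g ℤ.+ g n

sumℚ : ℕ → (ℕ → ℚ) → ℚ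
sumℚ zero    g = 0ℚ
sumℚ (suc n) g = sumℚ n g ℚ.+ g n

sumℕ : ℕ → (ℕ → ℕ) → ℕ
sumℕ zero    g = 0
sumℕ (suc n) g = sumℕ n g ℕ.+ g n

-- The polynomial families f^(i), t^(i), d^(i), s^(i), given as the
-- polynomial functions X ↦ f^(i)(X) on ℤ (evaluation commutes with the
-- recursions, which only use ring operations and integer binomials).

-- t^(j)(x) from a table g of the values f^(0)(x), …, f^(j)(x)
tOf : ℤ → (ℕ → ℤ) → ℕ → ℤ
tOf x g j = sumℤ (suc j) (λ k → + (j C k) ℤ.* (x ℤ.^ (j ∸ k)) ℤ.* g k)

dOf : ℤ → (ℕ → ℤ) → ℕ → ℤ
dOf x g j = tOf x g j ℤ.- x ℤ.* g j

sOf : ℤ → (ℕ → ℤ) → ℕ → ℤ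
sOf x g j = g j ℤ.+ dOf x g j

fNew : ℤ → (ℕ → ℤ) → ℕ → ℤ
fNew x g i = sumℤ i (λ j → + (i C j) ℤ.* (x ℤ.^ (i ∸ 1 ∸ j)) ℤ.* sOf x g j)

-- fTable x n k = f^(k)(x) for all k ≤ n
fTable : ℤ → ℕ → (ℕ → ℤ)
fTable x zero    = λ _ → + 1
fTable x (suc n) = λ k → if k ≤ᵇ n then fTable x n k else fNew x (fTable x n) (suc n)

f : ℕ → ℤ → ℤ
f i x = fTable x i i

t : ℕ → ℤ → ℤ
t i x = tOf x (fTable x i) i

d : ℕ → ℤ → ℤ
d i x = dOf x (fTable x i) i

s : ℕ → ℤ → ℤ
s i x = sOf x (fTable x i) i

G : ℕ → ℕ → ℕ
G m zero          = 0
G m (suc zero)    = 1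
G m (suc (suc k)) = m ℕ.* G m (suc k) ℕ.+ G m k

-- Polynomials over ℚ in the variable n, as coefficient functions
-- (coefficient of n^j).

termCoeff : (a : ℕ → ℤ → ℤ) (m : ℕ) .{{_ : NonZero m}} (p i : ℕ) → ℚ
termCoeff a m p i =
  ((ℤ.-1ℤ ℤ.^ i) ℤ.* + (p C i) ℤ.* a i (+ m)) ℚ./ (m ℕ.^ suc i)
    where instance _ = m^n≢0 m (suc i)

-- coefficient of n^j in  Σ_{i=0}^p termCoeff a m p i · n^(p-i)
polyCoeff : (a : ℕ → ℤ → ℤ) (m : ℕ) .{{_ : NonZero m}} (p : ℕ) → ℕ → ℚ
polyCoeff a m p j = if j ≤ᵇ p then termCoeff a m p (p ∸ j) else 0ℚ

Fc : (m : ℕ) .{{_ : NonZero m}} (p : ℕ) → ℕ → ℚ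
Fc = polyCoeff f

Tc : (m : ℕ) .{{_ : NonZero m}} (p : ℕ) → ℕ → ℚ
Tc = polyCoeff t

HasDegree : (ℕ → ℚ) → ℕ → Set
HasDegree c p = (c p ≢ 0ℚ) × (∀ j → p ℕ.< j → c j ≡ 0ℚ)

evalPoly : (ℕ → ℚ) → ℕ → ℕ → ℚ
evalPoly c p n = sumℚ (suc p) (λ j → c j ℚ.* (+ (n ℕ.^ j) ℚ./ 1))

module Submission where

-- Put a i = (-1)^i f^(i)(m) / m^(i+1) and b i = (-1)^i t^(i)(m) / m^(i+1).  Then
-- F(x) = Σ C(p,i) a_i x^(p-i) is the p-th term of the binomial convolution of a with
-- (x^k)_k, i.e. of the product of exponential generating functions A(z) e^(xz).  The
-- recursions for t and f become B(z) = A(z) e^(-z) and A(z) (e^z + m - e^(-z)) = e^z,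
-- which give T(x+1) = F(x) and F(x+1) + m F(x) - T(x) = (x+1)^p.  The summation
-- formula then follows by induction on n from G(n+2) = m G(n+1) + G(n).

open import Defs
open import Data.Nat using (ℕ; suc; _^_; _≤_; NonZero) renaming (_*_ to _*ℕ_)
open import Data.Integer using (+_)
open import Data.Rational using (ℚ; _/_; _+_; _-_; _*_)
open import Data.Product using (_×_)
open import Relation.Binary.PropositionalEquality using (_≡_)

open import Algebra.Bundles using (CommutativeRing)
open import Data.Bool as Bool using (true; false; if_then_else_)
open import Data.Empty using (⊥-elim)
open import Relation.Nullary using (yes; no)
open import Data.Nat as ℕ using (zero; _∸_; _≤ᵇ_; _<_)
import Data.Nat.Properties as ℕP
open import Data.Nat.Combinatorics using (_C_; nCk+nC[k+1]≡[n+1]C[k+1])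
open import Data.Integer as ℤ using (ℤ)
import Data.Integer.Properties as ℤP
open import Data.Rational using (0ℚ; 1ℚ; -_; toℚᵘ)
import Data.Rational.Properties as ℚP
import Data.Rational.Unnormalised as ℚᵘ
import Data.Rational.Unnormalised.Properties as ℚᵘP
open import Data.Rational.Solver using (module +-*-Solver)
open import Data.Product using (_,_)
open import Relation.Binary.PropositionalEquality
  using (_≢_; refl; sym; trans; cong; cong₂; subst; _≗_; module ≡-Reasoning)

open import Algebra.Properties.CommutativeSemiring.Exp
  (CommutativeRing.commutativeSemiring ℚP.+-*-commutativeRing)
  using (^-distrib-*) renaming (_^_ to _^ℚ_)
open +-*-Solver using (solve; _:=_; _:+_; _:*_; :-_; _:-_; con)
open ≡-Reasoning

fromℤ : ℤ → ℚ
fromℤ z = z / 1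

fromℕ : ℕ → ℚ
fromℕ n = fromℤ (+ n)

toℚᵘ-fromℤ : ∀ z → toℚᵘ (fromℤ z) ℚᵘ.≃ ℚᵘ.mkℚᵘ z 0
toℚᵘ-fromℤ z = ℚP.toℚᵘ-fromℚᵘ (ℚᵘ.mkℚᵘ z 0)

toℚᵘ≃⇒fromℤ≡ : ∀ {q} z → toℚᵘ q ℚᵘ.≃ ℚᵘ.mkℚᵘ z 0 → fromℤ z ≡ q
toℚᵘ≃⇒fromℤ≡ z q≃z = ℚP.toℚᵘ-injective (ℚᵘP.≃-trans (toℚᵘ-fromℤ z) (ℚᵘP.≃-sym q≃z))

fromℤ-homo-+ : ∀ a b → fromℤ (a ℤ.+ b) ≡ fromℤ a + fromℤ b
fromℤ-homo-+ a b = toℚᵘ≃⇒fromℤ≡ (a ℤ.+ b) (ℚᵘP.≃-trans (ℚP.toℚᵘ-homo-+ (fromℤ a) (fromℤ b))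
  (ℚᵘP.≃-trans (ℚᵘP.+-cong (toℚᵘ-fromℤ a) (toℚᵘ-fromℤ b))
    (ℚᵘP.≃-reflexive (cong (λ z → ℚᵘ.mkℚᵘ z 0) (cong₂ ℤ._+_ (ℤP.*-identityʳ a) (ℤP.*-identityʳ b))))))

fromℤ-homo-* : ∀ a b → fromℤ (a ℤ.* b) ≡ fromℤ a * fromℤ b
fromℤ-homo-* a b = toℚᵘ≃⇒fromℤ≡ (a ℤ.* b) (ℚᵘP.≃-trans (ℚP.toℚᵘ-homo-* (fromℤ a) (fromℤ b))
  (ℚᵘP.*-cong (toℚᵘ-fromℤ a) (toℚᵘ-fromℤ b)))

fromℤ-homo‿- : ∀ a → fromℤ (ℤ.- a) ≡ - fromℤ a
fromℤ-homo‿- a = toℚᵘ≃⇒fromℤ≡ (ℤ.- a) (ℚᵘP.≃-trans (ℚP.toℚᵘ-homo‿- (fromℤ a))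
  (ℚᵘP.-‿cong (toℚᵘ-fromℤ a)))

fromℤ-homo-^ : ∀ a n → fromℤ (a ℤ.^ n) ≡ fromℤ a ^ℚ n
fromℤ-homo-^ a zero    = refl
fromℤ-homo-^ a (suc n) = trans (fromℤ-homo-* a (a ℤ.^ n)) (cong (fromℤ a *_) (fromℤ-homo-^ a n))

fromℤ-homo-sum : ∀ n g → fromℤ (sumℤ n g) ≡ sumℚ n (λ i → fromℤ (g i))
fromℤ-homo-sum zero    g = refl
fromℤ-homo-sum (suc n) g = trans (fromℤ-homo-+ (sumℤ n g) (g n)) (cong (_+ fromℤ (g n)) (fromℤ-homo-sum n g))

fromℕ-homo-+ : ∀ a b → fromℕ (a ℕ.+ b) ≡ fromℕ a + fromℕ b
fromℕ-homo-+ a b = fromℤ-homo-+ (+ a) (+ b)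

fromℕ-homo-* : ∀ a b → fromℕ (a *ℕ b) ≡ fromℕ a * fromℕ b
fromℕ-homo-* a b = trans (cong fromℤ (ℤP.pos-* a b)) (fromℤ-homo-* (+ a) (+ b))

fromℕ-homo-^ : ∀ a n → fromℕ (a ^ n) ≡ fromℕ a ^ℚ n
fromℕ-homo-^ a zero    = refl
fromℕ-homo-^ a (suc n) = trans (fromℕ-homo-* a (a ^ n)) (cong (fromℕ a *_) (fromℕ-homo-^ a n))

z/n*n≡z : ∀ z n .{{_ : NonZero n}} → z / n * fromℕ n ≡ fromℤ z
z/n*n≡z z n@(suc n-1) = sym (toℚᵘ≃⇒fromℤ≡ z (ℚᵘP.≃-trans (ℚP.toℚᵘ-homo-* (z / n) (fromℕ n))
  (ℚᵘP.≃-trans (ℚᵘP.*-cong (ℚP.toℚᵘ-fromℚᵘ (ℚᵘ.mkℚᵘ z n-1)) (toℚᵘ-fromℤ (+ n)))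
    (ℚᵘ.*≡* (ℤP.*-assoc z (+ n) (+ 1))))))

sumℤ-cong : ∀ n {g h : ℕ → ℤ} → (∀ i → i < n → g i ≡ h i) → sumℤ n g ≡ sumℤ n h
sumℤ-cong zero    g≡h = refl
sumℤ-cong (suc n) g≡h = cong₂ ℤ._+_ (sumℤ-cong n (λ i i<n → g≡h i (ℕP.m<n⇒m<1+n i<n))) (g≡h n ℕP.≤-refl)

sumℚ-cong : ∀ n {g h : ℕ → ℚ} → (∀ i → i < n → g i ≡ h i) → sumℚ n g ≡ sumℚ n h
sumℚ-cong zero    g≡h = refl
sumℚ-cong (suc n) g≡h = cong₂ _+_ (sumℚ-cong n (λ i i<n → g≡h i (ℕP.m<n⇒m<1+n i<n))) (g≡h n ℕP.≤-refl)

sumℚ-distrib-+ : ∀ n (g h : ℕ → ℚ) → sumℚ n (λ i → g i + h i) ≡ sumℚ n g + sumℚ n h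
sumℚ-distrib-+ zero    g h = refl
sumℚ-distrib-+ (suc n) g h = trans (cong (_+ (g n + h n)) (sumℚ-distrib-+ n g h))
  (solve 4 (λ a b c d → (a :+ b) :+ (c :+ d) := (a :+ c) :+ (b :+ d)) refl (sumℚ n g) (sumℚ n h) (g n) (h n))

*-distribˡ-sumℚ : ∀ n c (g : ℕ → ℚ) → c * sumℚ n g ≡ sumℚ n (λ i → c * g i)
*-distribˡ-sumℚ zero    c g = ℚP.*-zeroʳ c
*-distribˡ-sumℚ (suc n) c g = trans (ℚP.*-distribˡ-+ c (sumℚ n g) (g n)) (cong (_+ c * g n) (*-distribˡ-sumℚ n c g))

sumℚ-suc-head : ∀ n (g : ℕ → ℚ) → sumℚ (suc n) g ≡ g 0 + sumℚ n (λ i → g (suc i))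
sumℚ-suc-head zero    g = trans (ℚP.+-identityˡ (g 0)) (sym (ℚP.+-identityʳ (g 0)))
sumℚ-suc-head (suc n) g = trans (cong (_+ g (suc n)) (sumℚ-suc-head n g))
  (ℚP.+-assoc (g 0) (sumℚ n (λ i → g (suc i))) (g (suc n)))

sumℚ-reverse : ∀ n (g : ℕ → ℚ) → sumℚ n (λ j → g (n ∸ suc j)) ≡ sumℚ n g
sumℚ-reverse zero    g = refl
sumℚ-reverse (suc n) g = begin
  sumℚ n (λ j → g (suc n ∸ suc j)) + g (n ∸ n)
    ≡⟨ cong₂ _+_ (sumℚ-cong n (λ j j<n → cong g (ℕP.+-∸-assoc 1 j<n))) (cong g (ℕP.n∸n≡0 n)) ⟩
  sumℚ n (λ j → g (suc (n ∸ suc j))) + g 0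
    ≡⟨ cong (_+ g 0) (sumℚ-reverse n (λ i → g (suc i))) ⟩
  sumℚ n (λ i → g (suc i)) + g 0
    ≡⟨ ℚP.+-comm _ (g 0) ⟩
  g 0 + sumℚ n (λ i → g (suc i))
    ≡⟨ sumℚ-suc-head n g ⟨
  sumℚ (suc n) g ∎

binomial : ℕ → ℕ → ℚ
binomial _       zero    = 1ℚ
binomial zero    (suc k) = 0ℚ
binomial (suc n) (suc k) = binomial n k + binomial n (suc k)

binomial≡fromℕ-C : ∀ n k → binomial n k ≡ fromℕ (n C k)
binomial≡fromℕ-C n       zero    = refl
binomial≡fromℕ-C zero    (suc k) = refl
binomial≡fromℕ-C (suc n) (suc k) = begin
  binomial n k + binomial n (suc k)  ≡⟨ cong₂ _+_ (binomial≡fromℕ-C n k) (binomial≡fromℕ-C n (suc k)) ⟩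
  fromℕ (n C k) + fromℕ (n C suc k)  ≡⟨ fromℕ-homo-+ (n C k) (n C suc k) ⟨
  fromℕ (n C k ℕ.+ n C suc k)        ≡⟨ cong fromℕ (nCk+nC[k+1]≡[n+1]C[k+1] n k) ⟩
  fromℕ (suc n C suc k)              ∎

n<k⇒binomial≡0 : ∀ {n k} → n < k → binomial n k ≡ 0ℚ
n<k⇒binomial≡0 {zero}  {suc k} _ = refl
n<k⇒binomial≡0 {suc n} {suc k} (ℕ.s≤s n<k) =
  cong₂ _+_ (n<k⇒binomial≡0 n<k) (n<k⇒binomial≡0 (ℕP.m<n⇒m<1+n n<k))

binomial-n-n : ∀ n → binomial n n ≡ 1ℚ
binomial-n-n zero    = refl
binomial-n-n (suc n) = cong₂ _+_ (binomial-n-n n) (n<k⇒binomial≡0 (ℕP.n<1+n n))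

Seq : Set
Seq = ℕ → ℚ

infixl 7 _⋆_ _∙_
infixl 6 _⊕_

-- Binomial convolution: the product of exponential generating functions.
_⋆_ : Seq → Seq → Seq
(x ⋆ y) k = sumℚ (suc k) (λ i → binomial k i * x i * y (k ∸ i))

_⊕_ : Seq → Seq → Seq
(x ⊕ y) i = x i + y i

_∙_ : ℚ → Seq → Seq
(c ∙ x) i = c * x i

shift : Seq → Seq
shift x i = x (suc i)

geometric : ℚ → Seq
geometric c k = c ^ℚ k

δ : Seq
δ = geometric 0ℚ

⋆-shift : ∀ x y k → (x ⋆ y) (suc k) ≡ (shift x ⋆ y) k + (x ⋆ shift y) k
⋆-shift x y k = begin
  (x ⋆ y) (suc k)                          ≡⟨ sumℚ-suc-head (suc k) h ⟩
  h 0 + sumℚ (suc k) (λ i → h (suc i))     ≡⟨ cong (_+_ (h 0)) (trans (sumℚ-cong (suc k) (λ i _ → pascal i)) (sumℚ-distrib-+ (suc k) A B)) ⟩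
  h 0 + (sumℚ (suc k) A + sumℚ (suc k) B)  ≡⟨ solve 3 (λ a b c → a :+ (b :+ c) := b :+ (a :+ c)) refl (h 0) (sumℚ (suc k) A) (sumℚ (suc k) B) ⟩
  sumℚ (suc k) A + (h 0 + sumℚ (suc k) B)  ≡⟨ cong (_+_ (sumℚ (suc k) A)) shifted-right ⟨
  (shift x ⋆ y) k + (x ⋆ shift y) k        ∎
  where
  h A B q : ℕ → ℚ
  h i = binomial (suc k) i * x i * y (suc k ∸ i)
  A i = binomial k i * x (suc i) * y (k ∸ i)
  B i = binomial k (suc i) * x (suc i) * y (k ∸ i)
  q i = binomial k i * x i * y (suc k ∸ i)

  pascal : ∀ i → h (suc i) ≡ A i + B i
  pascal i = solve 4 (λ a b c d → (a :+ b) :* c :* d := a :* c :* d :+ b :* c :* d) refl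
    (binomial k i) (binomial k (suc i)) (x (suc i)) (y (k ∸ i))

  q-last : q (suc k) ≡ 0ℚ
  q-last = begin
    binomial k (suc k) * x (suc k) * y (k ∸ k)  ≡⟨ cong (λ b → b * x (suc k) * y (k ∸ k)) (n<k⇒binomial≡0 (ℕP.n<1+n k)) ⟩
    0ℚ * x (suc k) * y (k ∸ k)                  ≡⟨ solve 2 (λ a b → con 0ℚ :* a :* b := con 0ℚ) refl (x (suc k)) (y (k ∸ k)) ⟩
    0ℚ                                    ∎

  shifted-right : (x ⋆ shift y) k ≡ h 0 + sumℚ (suc k) B
  shifted-right = begin
    (x ⋆ shift y) k
      ≡⟨ sumℚ-cong (suc k) (λ i i<1+k → cong (λ j → binomial k i * x i * y j) (sym (ℕP.+-∸-assoc 1 (ℕP.≤-pred i<1+k)))) ⟩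
    sumℚ (suc k) q
      ≡⟨ trans (cong (_+_ (sumℚ (suc k) q)) q-last) (ℚP.+-identityʳ _) ⟨
    sumℚ (suc (suc k)) q
      ≡⟨ sumℚ-suc-head (suc k) q ⟩
    h 0 + sumℚ (suc k) B ∎

⋆-cong : ∀ {x x' y y'} → x ≗ x' → y ≗ y' → x ⋆ y ≗ x' ⋆ y'
⋆-cong x≗x' y≗y' k = sumℚ-cong (suc k) (λ i _ → cong₂ (λ u v → binomial k i * u * v) (x≗x' i) (y≗y' (k ∸ i)))

⋆-congˡ : ∀ {x x'} y → x ≗ x' → x ⋆ y ≗ x' ⋆ y
⋆-congˡ y x≗x' = ⋆-cong {y = y} {y' = y} x≗x' (λ _ → refl)

⋆-congʳ : ∀ x {y y'} → y ≗ y' → x ⋆ y ≗ x ⋆ y'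
⋆-congʳ x = ⋆-cong {x = x} {x' = x} (λ _ → refl)

⋆-distribʳ-⊕ : ∀ x x' y → (x ⊕ x') ⋆ y ≗ x ⋆ y ⊕ x' ⋆ y
⋆-distribʳ-⊕ x x' y k = trans
  (sumℚ-cong (suc k) (λ i _ → solve 4 (λ b u v w → b :* (u :+ v) :* w := b :* u :* w :+ b :* v :* w) refl
    (binomial k i) (x i) (x' i) (y (k ∸ i))))
  (sumℚ-distrib-+ (suc k) _ _)

⋆-∙ˡ : ∀ c x y → (c ∙ x) ⋆ y ≗ c ∙ (x ⋆ y)
⋆-∙ˡ c x y k = trans
  (sumℚ-cong (suc k) (λ i _ → solve 4 (λ b c u w → b :* (c :* u) :* w := c :* (b :* u :* w)) refl
    (binomial k i) c (x i) (y (k ∸ i))))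
  (sym (*-distribˡ-sumℚ (suc k) c _))

⋆-∙ʳ : ∀ c x y → x ⋆ (c ∙ y) ≗ c ∙ (x ⋆ y)
⋆-∙ʳ c x y k = trans
  (sumℚ-cong (suc k) (λ i _ → solve 4 (λ b c u w → b :* u :* (c :* w) := c :* (b :* u :* w)) refl
    (binomial k i) c (x i) (y (k ∸ i))))
  (sym (*-distribˡ-sumℚ (suc k) c _))

shift-⋆-geometric : ∀ x c k → (x ⋆ geometric c) (suc k) ≡ (shift x ⋆ geometric c) k + c * (x ⋆ geometric c) k
shift-⋆-geometric x c k = trans (⋆-shift x (geometric c) k) (cong (_+_ ((shift x ⋆ geometric c) k)) (⋆-∙ʳ c x (geometric c) k))

⋆-identityʳ : ∀ x → x ⋆ δ ≗ x
⋆-identityʳ x zero    = solve 1 (λ a → con 0ℚ :+ con 1ℚ :* a :* con 1ℚ := a) refl (x 0)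
⋆-identityʳ x (suc k) = begin
  (x ⋆ δ) (suc k)                          ≡⟨ shift-⋆-geometric x 0ℚ k ⟩
  (shift x ⋆ δ) k + 0ℚ * (x ⋆ δ) k         ≡⟨ cong (_+ 0ℚ * (x ⋆ δ) k) (⋆-identityʳ (shift x) k) ⟩
  x (suc k) + 0ℚ * (x ⋆ δ) k               ≡⟨ solve 2 (λ a b → a :+ con 0ℚ :* b := a) refl (x (suc k)) ((x ⋆ δ) k) ⟩
  x (suc k)                                ∎

⋆-identityˡ : ∀ y → δ ⋆ y ≗ y
⋆-identityˡ y zero    = solve 1 (λ a → con 0ℚ :+ con 1ℚ :* con 1ℚ :* a := a) refl (y 0)
⋆-identityˡ y (suc k) = begin
  (δ ⋆ y) (suc k)                          ≡⟨ ⋆-shift δ y k ⟩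
  (0ℚ ∙ δ ⋆ y) k + (δ ⋆ shift y) k         ≡⟨ cong₂ _+_ (⋆-∙ˡ 0ℚ δ y k) (⋆-identityˡ (shift y) k) ⟩
  0ℚ * (δ ⋆ y) k + y (suc k)               ≡⟨ solve 2 (λ a b → con 0ℚ :* b :+ a := a) refl (y (suc k)) ((δ ⋆ y) k) ⟩
  y (suc k)                                ∎

⋆-geometric-+ : ∀ c d x → (x ⋆ geometric c) ⋆ geometric d ≗ x ⋆ geometric (c + d)
⋆-geometric-+ c d x zero    =
  solve 1 (λ a → con 0ℚ :+ con 1ℚ :* (con 0ℚ :+ con 1ℚ :* a :* con 1ℚ) :* con 1ℚ := con 0ℚ :+ con 1ℚ :* a :* con 1ℚ) refl (x 0)
⋆-geometric-+ c d x (suc k) = begin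
  (x ⋆ Ec ⋆ Ed) (suc k)
    ≡⟨ shift-⋆-geometric (x ⋆ Ec) d k ⟩
  (shift (x ⋆ Ec) ⋆ Ed) k + d * (x ⋆ Ec ⋆ Ed) k
    ≡⟨ cong (_+ d * (x ⋆ Ec ⋆ Ed) k) (⋆-congˡ Ed (shift-⋆-geometric x c) k) ⟩
  ((shift x ⋆ Ec ⊕ c ∙ (x ⋆ Ec)) ⋆ Ed) k + d * (x ⋆ Ec ⋆ Ed) k
    ≡⟨ cong (_+ d * (x ⋆ Ec ⋆ Ed) k) (trans (⋆-distribʳ-⊕ (shift x ⋆ Ec) (c ∙ (x ⋆ Ec)) Ed k)
         (cong (_+_ ((shift x ⋆ Ec ⋆ Ed) k)) (⋆-∙ˡ c (x ⋆ Ec) Ed k))) ⟩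
  (shift x ⋆ Ec ⋆ Ed) k + c * (x ⋆ Ec ⋆ Ed) k + d * (x ⋆ Ec ⋆ Ed) k
    ≡⟨ cong₂ (λ u v → u + c * v + d * v) (⋆-geometric-+ c d (shift x) k) (⋆-geometric-+ c d x k) ⟩
  (shift x ⋆ Ecd) k + c * (x ⋆ Ecd) k + d * (x ⋆ Ecd) k
    ≡⟨ solve 4 (λ u v c d → u :+ c :* v :+ d :* v := u :+ (c :+ d) :* v) refl ((shift x ⋆ Ecd) k) ((x ⋆ Ecd) k) c d ⟩
  (shift x ⋆ Ecd) k + (c + d) * (x ⋆ Ecd) k
    ≡⟨ shift-⋆-geometric x (c + d) k ⟨
  (x ⋆ Ecd) (suc k) ∎
  where
  Ec Ed Ecd : Seq
  Ec  = geometric c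
  Ed  = geometric d
  Ecd = geometric (c + d)

twist : ℚ → Seq → Seq
twist c x i = c ^ℚ i * x i

shift-twist : ∀ c x → shift (twist c x) ≗ c ∙ twist c (shift x)
shift-twist c x i = ℚP.*-assoc c (c ^ℚ i) (x (suc i))

twist-geometric : ∀ c d → twist c (geometric d) ≗ geometric (c * d)
twist-geometric c d i = sym (^-distrib-* c d i)

⋆-twist : ∀ c x y → twist c x ⋆ twist c y ≗ twist c (x ⋆ y)
⋆-twist c x y zero    =
  solve 2 (λ a b → con 0ℚ :+ con 1ℚ :* (con 1ℚ :* a) :* (con 1ℚ :* b) := con 1ℚ :* (con 0ℚ :+ con 1ℚ :* a :* b)) refl (x 0) (y 0)
⋆-twist c x y (suc k) = begin
  (twist c x ⋆ twist c y) (suc k)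
    ≡⟨ ⋆-shift (twist c x) (twist c y) k ⟩
  (shift (twist c x) ⋆ twist c y) k + (twist c x ⋆ shift (twist c y)) k
    ≡⟨ cong₂ _+_ (trans (⋆-congˡ (twist c y) (shift-twist c x) k) (⋆-∙ˡ c (twist c (shift x)) (twist c y) k))
                 (trans (⋆-congʳ (twist c x) (shift-twist c y) k) (⋆-∙ʳ c (twist c x) (twist c (shift y)) k)) ⟩
  c * (twist c (shift x) ⋆ twist c y) k + c * (twist c x ⋆ twist c (shift y)) k
    ≡⟨ cong₂ (λ u v → c * u + c * v) (⋆-twist c (shift x) y k) (⋆-twist c x (shift y) k) ⟩
  c * (c ^ℚ k * (shift x ⋆ y) k) + c * (c ^ℚ k * (x ⋆ shift y) k)
    ≡⟨ solve 4 (λ c p u v → c :* (p :* u) :+ c :* (p :* v) := (c :* p) :* (u :+ v)) refl c (c ^ℚ k) ((shift x ⋆ y) k) ((x ⋆ shift y) k) ⟩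
  c ^ℚ suc k * ((shift x ⋆ y) k + (x ⋆ shift y) k)
    ≡⟨ cong (c ^ℚ suc k *_) (⋆-shift x y k) ⟨
  twist c (x ⋆ y) (suc k) ∎

geometric-⋆-geometric : ∀ c d → geometric c ⋆ geometric d ≗ geometric (c + d)
geometric-⋆-geometric c d k = begin
  (geometric c ⋆ geometric d) k      ≡⟨ ⋆-congˡ (geometric d) (λ i → sym (⋆-identityˡ (geometric c) i)) k ⟩
  (δ ⋆ geometric c ⋆ geometric d) k  ≡⟨ ⋆-geometric-+ c d δ k ⟩
  (δ ⋆ geometric (c + d)) k          ≡⟨ ⋆-identityˡ (geometric (c + d)) k ⟩
  geometric (c + d) k                ∎

⋆-geometric-cancel : ∀ c x → x ⋆ geometric (- c) ⋆ geometric c ≗ x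
⋆-geometric-cancel c x k = begin
  (x ⋆ geometric (- c) ⋆ geometric c) k  ≡⟨ ⋆-geometric-+ (- c) c x k ⟩
  (x ⋆ geometric (- c + c)) k            ≡⟨ ⋆-congʳ x (λ i → cong (_^ℚ i) (ℚP.+-inverseˡ c)) k ⟩
  (x ⋆ δ) k                              ≡⟨ ⋆-identityʳ x k ⟩
  x k                                    ∎

if-≤ᵇ-then : ∀ {A : Set} {k n} {a b : A} → k ≤ n → (if k ≤ᵇ n then a else b) ≡ a
if-≤ᵇ-then {k = k} {n} k≤n with k ≤ᵇ n | ℕP.≤⇒≤ᵇ k≤n
... | true | _ = refl

if-≤ᵇ-else : ∀ {A : Set} {k n} {a b : A} → n < k → (if k ≤ᵇ n then a else b) ≡ b
if-≤ᵇ-else {k = k} {n} n<k with k ≤ᵇ n in k≤ᵇn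
... | false = refl
... | true  = ⊥-elim (ℕP.<⇒≱ n<k (ℕP.≤ᵇ⇒≤ k n (subst Bool.T (sym k≤ᵇn) _)))

fTable-stable : ∀ x n {k} → k ≤ n → fTable x n k ≡ f k x
fTable-stable x zero    ℕ.z≤n = refl
fTable-stable x (suc n) {k} k≤1+n with k ℕP.≤? n
... | yes k≤n = trans (if-≤ᵇ-then k≤n) (fTable-stable x n k≤n)
... | no  k≰n rewrite ℕP.≤-antisym k≤1+n (ℕP.≰⇒> k≰n) = refl

module _ (x : ℤ) {g h : ℕ → ℤ} where

  tOf-cong : ∀ j → (∀ l → l ≤ j → g l ≡ h l) → tOf x g j ≡ tOf x h j
  tOf-cong j g≡h = sumℤ-cong (suc j) (λ l l<1+j → cong (λ z → + (j C l) ℤ.* x ℤ.^ (j ∸ l) ℤ.* z) (g≡h l (ℕP.≤-pred l<1+j)))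

  sOf-cong : ∀ j → (∀ l → l ≤ j → g l ≡ h l) → sOf x g j ≡ sOf x h j
  sOf-cong j g≡h = cong₂ (λ v w → v ℤ.+ (w ℤ.- x ℤ.* v)) (g≡h j ℕP.≤-refl) (tOf-cong j g≡h)

  fNew-cong : ∀ i → (∀ l → l ≤ i → g l ≡ h l) → fNew x g (suc i) ≡ fNew x h (suc i)
  fNew-cong i g≡h = sumℤ-cong (suc i) (λ j j<1+i → cong (λ z → + (suc i C j) ℤ.* x ℤ.^ (i ∸ j) ℤ.* z)
    (sOf-cong j (λ l l≤j → g≡h l (ℕP.≤-trans l≤j (ℕP.≤-pred j<1+i)))))

module _ (x : ℤ) where

  private
    fₓ : ℕ → ℤ
    fₓ l = f l x

  t≡tOf-f : ∀ j → t j x ≡ tOf x fₓ j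
  t≡tOf-f j = tOf-cong x j (λ l → fTable-stable x j)

  s≡sOf-f : ∀ j → s j x ≡ sOf x fₓ j
  s≡sOf-f j = sOf-cong x j (λ l → fTable-stable x j)

  f-suc≡fNew-f : ∀ i → f (suc i) x ≡ fNew x fₓ (suc i)
  f-suc≡fNew-f i = trans (if-≤ᵇ-else (ℕP.n<1+n i)) (fNew-cong x i (λ l → fTable-stable x i))

fromℤ-binomial-term : ∀ n j x e z → fromℤ (+ (n C j) ℤ.* x ℤ.^ e ℤ.* z) ≡ binomial n j * fromℤ x ^ℚ e * fromℤ z
fromℤ-binomial-term n j x e z = begin
  fromℤ (+ (n C j) ℤ.* x ℤ.^ e ℤ.* z)          ≡⟨ fromℤ-homo-* (+ (n C j) ℤ.* x ℤ.^ e) z ⟩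
  fromℤ (+ (n C j) ℤ.* x ℤ.^ e) * fromℤ z      ≡⟨ cong (_* fromℤ z) (fromℤ-homo-* (+ (n C j)) (x ℤ.^ e)) ⟩
  fromℕ (n C j) * fromℤ (x ℤ.^ e) * fromℤ z    ≡⟨ cong₂ (λ b p → b * p * fromℤ z) (sym (binomial≡fromℕ-C n j)) (fromℤ-homo-^ x e) ⟩
  binomial n j * fromℤ x ^ℚ e * fromℤ z        ∎

fromℕ-suc : ∀ n → fromℕ (suc n) ≡ fromℕ n + 1ℚ
fromℕ-suc n = trans (cong fromℕ (ℕP.+-comm 1 n)) (fromℕ-homo-+ n 1)

*-fromℕ-cancelʳ : ∀ {q r} n .{{_ : NonZero n}} → q * fromℕ n ≡ r * fromℕ n → q ≡ r
*-fromℕ-cancelʳ {q} {r} n q*n≡r*n = begin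
  q                    ≡⟨ q≡[q*n]*v q ⟩
  q * fromℕ n * v      ≡⟨ cong (_* v) q*n≡r*n ⟩
  r * fromℕ n * v      ≡⟨ q≡[q*n]*v r ⟨
  r                    ∎
  where
  v : ℚ
  v = + 1 / n
  q≡[q*n]*v : ∀ q → q ≡ q * fromℕ n * v
  q≡[q*n]*v q = begin
    q                    ≡⟨ ℚP.*-identityʳ q ⟨
    q * 1ℚ               ≡⟨ cong (q *_) (trans (ℚP.*-comm (fromℕ n) v) (z/n*n≡z (+ 1) n)) ⟨
    q * (fromℕ n * v)    ≡⟨ ℚP.*-assoc q (fromℕ n) v ⟨
    q * fromℕ n * v      ∎

metallic-power-sum : ∀ m p (F T : ℚ → ℚ) →
  (∀ x → T (x + 1ℚ) ≡ F x) →
  (∀ x → F (x + 1ℚ) + fromℕ m * F x - T x ≡ (x + 1ℚ) ^ℚ p) →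
  ∀ n → fromℕ (sumℕ (suc n) (λ k → k ^ p *ℕ G m k)) ≡ F (fromℕ n) * fromℕ (G m n) + T (fromℕ n) * fromℕ (G m (suc n)) - T 0ℚ
metallic-power-sum m p F T T-shift F-shift zero = begin
  fromℕ (0 ℕ.+ 0 ^ p *ℕ 0)           ≡⟨ cong (λ z → fromℕ (0 ℕ.+ z)) (ℕP.*-zeroʳ (0 ^ p)) ⟩
  0ℚ                                 ≡⟨ solve 2 (λ F T → con 0ℚ := F :* con 0ℚ :+ T :* con 1ℚ :- T) refl (F 0ℚ) (T 0ℚ) ⟩
  F 0ℚ * 0ℚ + T 0ℚ * 1ℚ - T 0ℚ       ∎
metallic-power-sum m p F T T-shift F-shift (suc n) = begin
  fromℕ (sumℕ (suc n) g ℕ.+ g (suc n))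
    ≡⟨ fromℕ-homo-+ (sumℕ (suc n) g) (g (suc n)) ⟩
  fromℕ (sumℕ (suc n) g) + fromℕ (g (suc n))
    ≡⟨ cong₂ _+_ (metallic-power-sum m p F T T-shift F-shift n) new-term ⟩
  (F N * G₀ + T N * G₁ - T 0ℚ) + (N + 1ℚ) ^ℚ p * G₁
    ≡⟨ cong (λ z → (F N * G₀ + T N * G₁ - T 0ℚ) + z * G₁) (F-shift N) ⟨
  (F N * G₀ + T N * G₁ - T 0ℚ) + (F (N + 1ℚ) + fromℕ m * F N - T N) * G₁
    ≡⟨ solve 7 (λ FN G₀ TN G₁ T₀ F₁ M → (FN :* G₀ :+ TN :* G₁ :- T₀) :+ (F₁ :+ M :* FN :- TN) :* G₁ := F₁ :* G₁ :+ FN :* (M :* G₁ :+ G₀) :- T₀)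
         refl (F N) G₀ (T N) G₁ (T 0ℚ) (F (N + 1ℚ)) (fromℕ m) ⟩
  F (N + 1ℚ) * G₁ + F N * (fromℕ m * G₁ + G₀) - T 0ℚ
    ≡⟨ cong₂ (λ z w → F (N + 1ℚ) * G₁ + z * w - T 0ℚ) (T-shift N) G-recurrence ⟨
  F (N + 1ℚ) * G₁ + T (N + 1ℚ) * fromℕ (G m (suc (suc n))) - T 0ℚ
    ≡⟨ cong (λ x → F x * G₁ + T x * fromℕ (G m (suc (suc n))) - T 0ℚ) (fromℕ-suc n) ⟨
  F (fromℕ (suc n)) * G₁ + T (fromℕ (suc n)) * fromℕ (G m (suc (suc n))) - T 0ℚ ∎
  where
  g : ℕ → ℕ
  g k = k ^ p *ℕ G m k
  N G₀ G₁ : ℚ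
  N  = fromℕ n
  G₀ = fromℕ (G m n)
  G₁ = fromℕ (G m (suc n))
  new-term : fromℕ (g (suc n)) ≡ (N + 1ℚ) ^ℚ p * G₁
  new-term = trans (fromℕ-homo-* (suc n ^ p) (G m (suc n)))
    (cong (_* G₁) (trans (fromℕ-homo-^ (suc n) p) (cong (_^ℚ p) (fromℕ-suc n))))
  G-recurrence : fromℕ (G m (suc (suc n))) ≡ fromℕ m * G₁ + G₀
  G-recurrence = trans (fromℕ-homo-+ (m *ℕ G m (suc n)) (G m n)) (cong (_+ G₀) (fromℕ-homo-* m (G m (suc n))))

module MetallicOrder (m : ℕ) .{{_ : NonZero m}} where

  M u : ℚ
  M = fromℕ m
  u = + 1 / m

  u*M≡1 : u * M ≡ 1ℚ
  u*M≡1 = z/n*n≡z (+ 1) m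

  -u*M≡-1 : - u * M ≡ - 1ℚ
  -u*M≡-1 = trans (sym (ℚP.neg-distribˡ-* u M)) (cong -_ u*M≡1)

  fₘ tₘ sₘ : Seq
  fₘ j = fromℤ (f j (+ m))
  tₘ j = fromℤ (t j (+ m))
  sₘ j = fromℤ (s j (+ m))

  tₘ≗fₘ⋆geometric : tₘ ≗ fₘ ⋆ geometric M
  tₘ≗fₘ⋆geometric j = trans (cong fromℤ (t≡tOf-f (+ m) j)) (trans (fromℤ-homo-sum (suc j) _)
    (sumℚ-cong (suc j) (λ l _ → trans (fromℤ-binomial-term j l (+ m) (j ∸ l) (f l (+ m)))
      (solve 3 (λ b p y → b :* p :* y := b :* y :* p) refl (binomial j l) (M ^ℚ (j ∸ l)) (fₘ l)))))

  sₘ≗fₘ⊕tₘ⊕-M∙fₘ : sₘ ≗ fₘ ⊕ tₘ ⊕ (- M) ∙ fₘ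
  sₘ≗fₘ⊕tₘ⊕-M∙fₘ j = begin
    fromℤ (f j (+ m) ℤ.+ (t j (+ m) ℤ.- + m ℤ.* f j (+ m)))
      ≡⟨ fromℤ-homo-+ (f j (+ m)) _ ⟩
    fₘ j + fromℤ (t j (+ m) ℤ.- + m ℤ.* f j (+ m))
      ≡⟨ cong (_+_ (fₘ j)) (fromℤ-homo-+ (t j (+ m)) _) ⟩
    fₘ j + (tₘ j + fromℤ (ℤ.- (+ m ℤ.* f j (+ m))))
      ≡⟨ cong (λ z → fₘ j + (tₘ j + z)) (trans (fromℤ-homo‿- (+ m ℤ.* f j (+ m))) (cong -_ (fromℤ-homo-* (+ m) (f j (+ m))))) ⟩
    fₘ j + (tₘ j + - (M * fₘ j))
      ≡⟨ solve 3 (λ x y c → x :+ (y :+ :- (c :* x)) := x :+ y :+ (:- c) :* x) refl (fₘ j) (tₘ j) M ⟩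
    fₘ j + tₘ j + (- M) * fₘ j ∎

  fₘ-suc : ∀ k → fₘ (suc k) ≡ sumℚ (suc k) (λ j → binomial (suc k) j * M ^ℚ (k ∸ j) * sₘ j)
  fₘ-suc k = trans (cong fromℤ (f-suc≡fNew-f (+ m) k)) (trans (fromℤ-homo-sum (suc k) _)
    (sumℚ-cong (suc k) (λ j _ → trans (fromℤ-binomial-term (suc k) j (+ m) (k ∸ j) _)
      (cong (λ z → binomial (suc k) j * M ^ℚ (k ∸ j) * fromℤ z) (sym (s≡sOf-f (+ m) j))))))

  -- The δ term accounts for f^(0) = 1, which the recursion for f does not cover.
  fₘ-recursion : M ∙ fₘ ≗ sₘ ⋆ geometric M ⊕ (- 1ℚ) ∙ sₘ ⊕ M ∙ δ
  fₘ-recursion zero    =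
    solve 2 (λ c y → c :* con 1ℚ := (con 0ℚ :+ con 1ℚ :* y :* con 1ℚ) :+ (:- con 1ℚ) :* y :+ c :* con 1ℚ) refl M (sₘ 0)
  fₘ-recursion (suc k) = begin
    M * fₘ (suc k)                  ≡⟨ cong (M *_) (fₘ-suc k) ⟩
    M * sumℚ (suc k) g              ≡⟨ *-distribˡ-sumℚ (suc k) M g ⟩
    sumℚ (suc k) (λ j → M * g j)    ≡⟨ sumℚ-cong (suc k) (λ j j<1+k → M*g≡h j (ℕP.≤-pred j<1+k)) ⟩
    sumℚ (suc k) h
      ≡⟨ solve 4 (λ a y c z → a := (a :+ con 1ℚ :* y :* con 1ℚ) :+ (:- con 1ℚ) :* y :+ c :* (con 0ℚ :* z))
           refl (sumℚ (suc k) h) (sₘ (suc k)) M (0ℚ ^ℚ k) ⟩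
    sumℚ (suc k) h + 1ℚ * sₘ (suc k) * 1ℚ + (- 1ℚ) * sₘ (suc k) + M * δ (suc k)
      ≡⟨ cong₂ (λ b p → sumℚ (suc k) h + b * sₘ (suc k) * p + (- 1ℚ) * sₘ (suc k) + M * δ (suc k))
           (sym (binomial-n-n (suc k))) (cong (M ^ℚ_) (sym (ℕP.n∸n≡0 k))) ⟩
    (sₘ ⋆ geometric M) (suc k) + (- 1ℚ) * sₘ (suc k) + M * δ (suc k) ∎
    where
    g h : Seq
    g j = binomial (suc k) j * M ^ℚ (k ∸ j) * sₘ j
    h j = binomial (suc k) j * sₘ j * M ^ℚ (suc k ∸ j)
    M*g≡h : ∀ j → j ≤ k → M * g j ≡ h j
    M*g≡h j j≤k = trans
      (solve 4 (λ c b p y → c :* (b :* p :* y) := b :* y :* (c :* p)) refl M (binomial (suc k) j) (M ^ℚ (k ∸ j)) (sₘ j))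
      (cong (λ e → binomial (suc k) j * sₘ j * M ^ℚ e) (sym (ℕP.+-∸-assoc 1 j≤k)))

  normalise : Seq → Seq
  normalise y = u ∙ twist (- u) y

  normalise-⋆-geometric : ∀ y → normalise (y ⋆ geometric M) ≗ normalise y ⋆ geometric (- 1ℚ)
  normalise-⋆-geometric y k = begin
    u * twist (- u) (y ⋆ geometric M) k                  ≡⟨ cong (u *_) (⋆-twist (- u) y (geometric M) k) ⟨
    u * (twist (- u) y ⋆ twist (- u) (geometric M)) k    ≡⟨ cong (u *_) (⋆-congʳ (twist (- u) y) (λ i → trans (twist-geometric (- u) M i) (cong (_^ℚ i) -u*M≡-1)) k) ⟩
    u * (twist (- u) y ⋆ geometric (- 1ℚ)) k             ≡⟨ ⋆-∙ˡ u (twist (- u) y) (geometric (- 1ℚ)) k ⟨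
    (normalise y ⋆ geometric (- 1ℚ)) k                   ∎

  a b e : Seq
  a = normalise fₘ
  b = normalise tₘ
  e = normalise sₘ

  b≗a⋆geometric-1 : b ≗ a ⋆ geometric (- 1ℚ)
  b≗a⋆geometric-1 k = trans (cong (λ z → u * ((- u) ^ℚ k * z)) (tₘ≗fₘ⋆geometric k)) (normalise-⋆-geometric fₘ k)

  e≗a⊕b⊕-M∙a : e ≗ a ⊕ b ⊕ (- M) ∙ a
  e≗a⊕b⊕-M∙a k = trans (cong (λ z → u * ((- u) ^ℚ k * z)) (sₘ≗fₘ⊕tₘ⊕-M∙fₘ k))
    (solve 5 (λ u p y z c → u :* (p :* (y :+ z :+ (:- c) :* y)) := u :* (p :* y) :+ u :* (p :* z) :+ (:- c) :* (u :* (p :* y)))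
      refl u ((- u) ^ℚ k) (fₘ k) (tₘ k) M)

  M∙a≗e⋆geometric-1⊕-e⊕δ : M ∙ a ≗ e ⋆ geometric (- 1ℚ) ⊕ (- 1ℚ) ∙ e ⊕ δ
  M∙a≗e⋆geometric-1⊕-e⊕δ k = begin
    M * (u * (p * fₘ k))
      ≡⟨ solve 4 (λ c u p y → c :* (u :* (p :* y)) := u :* (p :* (c :* y))) refl M u p (fₘ k) ⟩
    u * (p * (M * fₘ k))
      ≡⟨ cong (λ z → u * (p * z)) (fₘ-recursion k) ⟩
    u * (p * ((sₘ ⋆ geometric M) k + (- 1ℚ) * sₘ k + M * δ k))
      ≡⟨ solve 6 (λ u p c y M d → u :* (p :* (c :+ (:- con 1ℚ) :* y :+ M :* d)) := u :* (p :* c) :+ (:- con 1ℚ) :* (u :* (p :* y)) :+ (u :* M) :* (p :* d))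
           refl u p ((sₘ ⋆ geometric M) k) (sₘ k) M (δ k) ⟩
    u * (p * (sₘ ⋆ geometric M) k) + (- 1ℚ) * e k + (u * M) * (p * δ k)
      ≡⟨ cong₂ (λ z w → z + (- 1ℚ) * e k + w) (normalise-⋆-geometric sₘ k) (cong₂ _*_ u*M≡1 twist-δ) ⟩
    (e ⋆ geometric (- 1ℚ)) k + (- 1ℚ) * e k + 1ℚ * δ k
      ≡⟨ cong (_+_ ((e ⋆ geometric (- 1ℚ)) k + (- 1ℚ) * e k)) (ℚP.*-identityˡ (δ k)) ⟩
    (e ⋆ geometric (- 1ℚ)) k + (- 1ℚ) * e k + δ k ∎
    where
    p : ℚ
    p = (- u) ^ℚ k
    twist-δ : p * δ k ≡ δ k
    twist-δ = trans (twist-geometric (- u) 0ℚ k) (cong (_^ℚ k) (ℚP.*-zeroʳ (- u)))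

  b⋆geometric1≗a : b ⋆ geometric 1ℚ ≗ a
  b⋆geometric1≗a k = trans (⋆-congˡ (geometric 1ℚ) b≗a⋆geometric-1 k) (⋆-geometric-cancel 1ℚ a k)

  e⋆geometric1-expansion : e ⋆ geometric 1ℚ ≗ a ⋆ geometric 1ℚ ⊕ a ⊕ (- M) ∙ (a ⋆ geometric 1ℚ)
  e⋆geometric1-expansion k = begin
    (e ⋆ E1) k                                ≡⟨ ⋆-congˡ E1 e≗a⊕b⊕-M∙a k ⟩
    ((a ⊕ b ⊕ (- M) ∙ a) ⋆ E1) k              ≡⟨ ⋆-distribʳ-⊕ (a ⊕ b) ((- M) ∙ a) E1 k ⟩
    ((a ⊕ b) ⋆ E1) k + ((- M) ∙ a ⋆ E1) k     ≡⟨ cong₂ _+_ (trans (⋆-distribʳ-⊕ a b E1 k) (cong (_+_ ((a ⋆ E1) k)) (b⋆geometric1≗a k)))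
                                                           (⋆-∙ˡ (- M) a E1 k) ⟩
    (a ⋆ E1) k + a k + (- M) * (a ⋆ E1) k     ∎
    where
    E1 : Seq
    E1 = geometric 1ℚ

  M∙[a⋆geometric1]-expansion : M ∙ (a ⋆ geometric 1ℚ) ≗ e ⊕ (- 1ℚ) ∙ (e ⋆ geometric 1ℚ) ⊕ geometric 1ℚ
  M∙[a⋆geometric1]-expansion k = begin
    M * (a ⋆ E1) k
      ≡⟨ ⋆-∙ˡ M a E1 k ⟨
    (M ∙ a ⋆ E1) k
      ≡⟨ ⋆-congˡ E1 M∙a≗e⋆geometric-1⊕-e⊕δ k ⟩
    ((e ⋆ geometric (- 1ℚ) ⊕ (- 1ℚ) ∙ e ⊕ δ) ⋆ E1) k
      ≡⟨ ⋆-distribʳ-⊕ (e ⋆ geometric (- 1ℚ) ⊕ (- 1ℚ) ∙ e) δ E1 k ⟩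
    ((e ⋆ geometric (- 1ℚ) ⊕ (- 1ℚ) ∙ e) ⋆ E1) k + (δ ⋆ E1) k
      ≡⟨ cong₂ _+_ (⋆-distribʳ-⊕ (e ⋆ geometric (- 1ℚ)) ((- 1ℚ) ∙ e) E1 k) (⋆-identityˡ E1 k) ⟩
    (e ⋆ geometric (- 1ℚ) ⋆ E1) k + ((- 1ℚ) ∙ e ⋆ E1) k + E1 k
      ≡⟨ cong (_+ E1 k) (cong₂ _+_ (⋆-geometric-cancel 1ℚ e k) (⋆-∙ˡ (- 1ℚ) e E1 k)) ⟩
    e k + (- 1ℚ) * (e ⋆ E1) k + E1 k ∎
    where
    E1 : Seq
    E1 = geometric 1ℚ

  a⋆geometric1⊕M∙a⊕-b≗geometric1 : a ⋆ geometric 1ℚ ⊕ M ∙ a ⊕ (- 1ℚ) ∙ b ≗ geometric 1ℚ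
  a⋆geometric1⊕M∙a⊕-b≗geometric1 k = cancel (begin
    M * (a ⋆ geometric 1ℚ) k
      ≡⟨ M∙[a⋆geometric1]-expansion k ⟩
    e k + (- 1ℚ) * (e ⋆ geometric 1ℚ) k + geometric 1ℚ k
      ≡⟨ cong₂ (λ z w → z + (- 1ℚ) * w + geometric 1ℚ k) (e≗a⊕b⊕-M∙a k) (e⋆geometric1-expansion k) ⟩
    a k + b k + (- M) * a k + (- 1ℚ) * ((a ⋆ geometric 1ℚ) k + a k + (- M) * (a ⋆ geometric 1ℚ) k) + geometric 1ℚ k ∎)
    where
    cancel : ∀ {A x y E} → M * A ≡ x + y + (- M) * x + (- 1ℚ) * (A + x + (- M) * A) + E → A + M * x + (- 1ℚ) * y ≡ E
    cancel {A} {x} {y} {E} M*A≡R = begin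
      A + M * x + (- 1ℚ) * y
        ≡⟨ solve 5 (λ A x y E M → A :+ M :* x :+ (:- con 1ℚ) :* y
                      := E :+ (M :* A :- (x :+ y :+ (:- M) :* x :+ (:- con 1ℚ) :* (A :+ x :+ (:- M) :* A) :+ E))) refl A x y E M ⟩
      E + (M * A - R)
        ≡⟨ cong (λ z → E + (z - R)) M*A≡R ⟩
      E + (R - R)
        ≡⟨ cong (_+_ E) (ℚP.+-inverseʳ R) ⟩
      E + 0ℚ
        ≡⟨ ℚP.+-identityʳ E ⟩
      E ∎
      where
      R : ℚ
      R = x + y + (- M) * x + (- 1ℚ) * (A + x + (- M) * A) + E

  F T : ℕ → ℚ → ℚ
  F p x = (a ⋆ geometric x) p
  T p x = (b ⋆ geometric x) p

  T-shift : ∀ p x → T p (x + 1ℚ) ≡ F p x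
  T-shift p x = begin
    (b ⋆ geometric (x + 1ℚ)) p                     ≡⟨ ⋆-congˡ (geometric (x + 1ℚ)) b≗a⋆geometric-1 p ⟩
    (a ⋆ geometric (- 1ℚ) ⋆ geometric (x + 1ℚ)) p  ≡⟨ ⋆-geometric-+ (- 1ℚ) (x + 1ℚ) a p ⟩
    (a ⋆ geometric (- 1ℚ + (x + 1ℚ))) p            ≡⟨ ⋆-congʳ a (λ i → cong (_^ℚ i) (solve 1 (λ x → :- con 1ℚ :+ (x :+ con 1ℚ) := x) refl x)) p ⟩
    (a ⋆ geometric x) p                            ∎

  F-shift : ∀ p x → F p (x + 1ℚ) + M * F p x - T p x ≡ (x + 1ℚ) ^ℚ p
  F-shift p x = begin
    F p (x + 1ℚ) + M * F p x - T p x
      ≡⟨ solve 4 (λ F1 c Fx Tx → F1 :+ c :* Fx :- Tx := F1 :+ c :* Fx :+ (:- con 1ℚ) :* Tx) refl (F p (x + 1ℚ)) M (F p x) (T p x) ⟩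
    F p (x + 1ℚ) + M * F p x + (- 1ℚ) * T p x
      ≡⟨ cong₂ _+_ (cong₂ _+_ F-at-x+1 (sym (⋆-∙ˡ M a Ex p))) (sym (⋆-∙ˡ (- 1ℚ) b Ex p)) ⟩
    (a ⋆ E1 ⋆ Ex) p + (M ∙ a ⋆ Ex) p + ((- 1ℚ) ∙ b ⋆ Ex) p
      ≡⟨ cong (_+ ((- 1ℚ) ∙ b ⋆ Ex) p) (⋆-distribʳ-⊕ (a ⋆ E1) (M ∙ a) Ex p) ⟨
    ((a ⋆ E1 ⊕ M ∙ a) ⋆ Ex) p + ((- 1ℚ) ∙ b ⋆ Ex) p
      ≡⟨ ⋆-distribʳ-⊕ (a ⋆ E1 ⊕ M ∙ a) ((- 1ℚ) ∙ b) Ex p ⟨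
    ((a ⋆ E1 ⊕ M ∙ a ⊕ (- 1ℚ) ∙ b) ⋆ Ex) p
      ≡⟨ ⋆-congˡ Ex a⋆geometric1⊕M∙a⊕-b≗geometric1 p ⟩
    (E1 ⋆ Ex) p
      ≡⟨ geometric-⋆-geometric 1ℚ x p ⟩
    (1ℚ + x) ^ℚ p
      ≡⟨ cong (_^ℚ p) (ℚP.+-comm 1ℚ x) ⟩
    (x + 1ℚ) ^ℚ p ∎
    where
    E1 Ex : Seq
    E1 = geometric 1ℚ
    Ex = geometric x
    F-at-x+1 : F p (x + 1ℚ) ≡ (a ⋆ E1 ⋆ Ex) p
    F-at-x+1 = trans (⋆-congʳ a (λ i → cong (_^ℚ i) (ℚP.+-comm x 1ℚ)) p) (sym (⋆-geometric-+ 1ℚ x a p))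

  u≢0 : u ≢ 0ℚ
  u≢0 u≡0 = ℚP.1≢0 (trans (sym u*M≡1) (trans (cong (_* M) u≡0) (ℚP.*-zeroˡ M)))

  normalise-head≢0 : ∀ y → y 0 ≡ 1ℚ → normalise y 0 ≢ 0ℚ
  normalise-head≢0 y y₀≡1 u*[1*y₀]≡0 = u≢0 (trans (sym u*[1*y₀]≡u) u*[1*y₀]≡0)
    where
    u*[1*y₀]≡u : u * (1ℚ * y 0) ≡ u
    u*[1*y₀]≡u = trans (cong (λ z → u * (1ℚ * z)) y₀≡1) (ℚP.*-identityʳ u)

  termCoeff≡binomial*normalise : ∀ g p i → termCoeff g m p i ≡ binomial p i * normalise (λ l → fromℤ (g l (+ m))) i
  termCoeff≡binomial*normalise g p i = *-fromℕ-cancelʳ (m ^ suc i) {{ℕP.m^n≢0 m (suc i)}}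
    (trans (z/n*n≡z z (m ^ suc i) {{ℕP.m^n≢0 m (suc i)}}) (sym (begin
      binomial p i * (u * (q * w)) * fromℕ (m ^ suc i)
        ≡⟨ cong (λ z → binomial p i * (u * (q * w)) * z) (fromℕ-homo-^ m (suc i)) ⟩
      binomial p i * (u * (q * w)) * (M * M ^ℚ i)
        ≡⟨ solve 6 (λ b u q w c r → b :* (u :* (q :* w)) :* (c :* r) := (u :* c) :* (q :* r) :* b :* w)
             refl (binomial p i) u q w M (M ^ℚ i) ⟩
      (u * M) * (q * M ^ℚ i) * binomial p i * w
        ≡⟨ cong₂ (λ x y → x * y * binomial p i * w) u*M≡1 (trans (sym (^-distrib-* (- u) M i)) (cong (_^ℚ i) -u*M≡-1)) ⟩
      1ℚ * (- 1ℚ) ^ℚ i * binomial p i * w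
        ≡⟨ cong (λ x → x * binomial p i * w) (ℚP.*-identityˡ ((- 1ℚ) ^ℚ i)) ⟩
      (- 1ℚ) ^ℚ i * binomial p i * w
        ≡⟨ cong₂ (λ x y → x * y * w) (fromℤ-homo-^ ℤ.-1ℤ i) (sym (binomial≡fromℕ-C p i)) ⟨
      fromℤ (ℤ.-1ℤ ℤ.^ i) * fromℕ (p C i) * w
        ≡⟨ trans (fromℤ-homo-* (ℤ.-1ℤ ℤ.^ i ℤ.* + (p C i)) (g i (+ m))) (cong (_* w) (fromℤ-homo-* (ℤ.-1ℤ ℤ.^ i) (+ (p C i)))) ⟨
      fromℤ z ∎)))
    where
    z : ℤ
    z = ℤ.-1ℤ ℤ.^ i ℤ.* + (p C i) ℤ.* g i (+ m)
    q w : ℚ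
    q = (- u) ^ℚ i
    w = fromℤ (g i (+ m))

  module _ (g : ℕ → ℤ → ℤ) (p : ℕ) where

    private
      ĝ : Seq
      ĝ = normalise (λ l → fromℤ (g l (+ m)))

    evalPoly-polyCoeff : ∀ n → evalPoly (polyCoeff g m p) p n ≡ (ĝ ⋆ geometric (fromℕ n)) p
    evalPoly-polyCoeff n = trans (sumℚ-cong (suc p) (λ j j<1+p → coefficient j (ℕP.≤-pred j<1+p))) (sumℚ-reverse (suc p) h)
      where
      h : Seq
      h i = binomial p i * ĝ i * fromℕ n ^ℚ (p ∸ i)
      coefficient : ∀ j → j ≤ p → polyCoeff g m p j * fromℕ (n ^ j) ≡ h (p ∸ j)
      coefficient j j≤p = cong₂ _*_ (trans (if-≤ᵇ-then j≤p) (termCoeff≡binomial*normalise g p (p ∸ j)))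
        (trans (fromℕ-homo-^ n j) (cong (fromℕ n ^ℚ_) (sym (ℕP.m∸[m∸n]≡n j≤p))))

    polyCoeff-leading : polyCoeff g m p p ≡ ĝ 0
    polyCoeff-leading = begin
      polyCoeff g m p p             ≡⟨ if-≤ᵇ-then (ℕP.≤-refl {p}) ⟩
      termCoeff g m p (p ∸ p)       ≡⟨ cong (termCoeff g m p) (ℕP.n∸n≡0 p) ⟩
      termCoeff g m p 0             ≡⟨ termCoeff≡binomial*normalise g p 0 ⟩
      1ℚ * ĝ 0                      ≡⟨ ℚP.*-identityˡ (ĝ 0) ⟩
      ĝ 0                           ∎

    polyCoeff-hasDegree : g 0 (+ m) ≡ + 1 → HasDegree (polyCoeff g m p) p
    polyCoeff-hasDegree g₀≡1 =
        (λ lead≡0 → normalise-head≢0 (λ l → fromℤ (g l (+ m))) (cong fromℤ g₀≡1) (trans (sym polyCoeff-leading) lead≡0))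
      , (λ j p<j → if-≤ᵇ-else p<j)

  Tc-constant : ∀ p → Tc m p 0 ≡ T p 0ℚ
  Tc-constant p = begin
    termCoeff t m p p    ≡⟨ termCoeff≡binomial*normalise t p p ⟩
    binomial p p * b p   ≡⟨ cong (_* b p) (binomial-n-n p) ⟩
    1ℚ * b p             ≡⟨ ℚP.*-identityˡ (b p) ⟩
    b p                  ≡⟨ ⋆-identityʳ b p ⟨
    T p 0ℚ               ∎

mainTheorem1 : (m : ℕ) .{{_ : NonZero m}} (p : ℕ) → 1 ≤ p →
    HasDegree (Fc m p) p × HasDegree (Tc m p) p ×
    ((n : ℕ) →
      (+ sumℕ (suc n) (λ k → k ^ p *ℕ G m k)) / 1
        ≡ evalPoly (Fc m p) p n * ((+ G m n) / 1)
          + evalPoly (Tc m p) p n * ((+ G m (suc n)) / 1)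
          - Tc m p 0)
mainTheorem1 m p _ = polyCoeff-hasDegree f p refl , polyCoeff-hasDegree t p refl , power-sum
  where
  open MetallicOrder m
  power-sum : ∀ n → fromℕ (sumℕ (suc n) (λ k → k ^ p *ℕ G m k))
                      ≡ evalPoly (Fc m p) p n * fromℕ (G m n) + evalPoly (Tc m p) p n * fromℕ (G m (suc n)) - Tc m p 0
  power-sum n = begin
    fromℕ (sumℕ (suc n) (λ k → k ^ p *ℕ G m k))
      ≡⟨ metallic-power-sum m p (F p) (T p) (T-shift p) (F-shift p) n ⟩
    F p (fromℕ n) * G₀ + T p (fromℕ n) * G₁ - T p 0ℚ
      ≡⟨ cong₂ (λ x y → x * G₀ + y * G₁ - T p 0ℚ) (evalPoly-polyCoeff f p n) (evalPoly-polyCoeff t p n) ⟨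
    evalPoly (Fc m p) p n * G₀ + evalPoly (Tc m p) p n * G₁ - T p 0ℚ
      ≡⟨ cong (λ c → evalPoly (Fc m p) p n * G₀ + evalPoly (Tc m p) p n * G₁ - c) (Tc-constant p) ⟨
    evalPoly (Fc m p) p n * G₀ + evalPoly (Tc m p) p n * G₁ - Tc m p 0 ∎
    where
    G₀ G₁ : ℚ
    G₀ = fromℕ (G m n)
    G₁ = fromℕ (G m (suc n))
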